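{- Let $n$ be a natural number, $Ks$ a set of keys and $G$ a set of messages such that every message of $G$ belongs to $\mathit{guard}\ n\ Ks$. If $\mathit{Nonce}\ n \in \mathit{analz}\ G$, then there exists a key $K \in Ks$ with $\mathit{Key}\ K \in \mathit{analz}\ G$.
   Context: Messages are elements of the free inductive datatype msg ::= Number nat | Nonce nat | Agent agent | Key key | Hash msg | ⟨msg, msg⟩ | Crypt key msg, where keys are natural numbers and agents are Server, Friend $i$ ($i\in\mathbb N$) or Spy. Constructors are injective with pairwise disjoint images. There is a function $\mathit{invKey}$ on keys giving the inverse of a key (for a public key $\mathit{pubK}\ A$ it is the private key $\mathit{priK}\ A$ and vice versa; a symmetric key is its own inverse). $\mathit{parts}\ H$ is the least set containing $H$ and closed under: $\langle X,Y\rangle \in \mathit{parts}\ H \Rightarrow X,Y\in \mathit{parts}\ H$; $\mathit{Crypt}\ K\ X\in \mathit{parts}\ H\Rightarrow X\in\mathit{parts}\ H$. $\mathit{analz}\ H$ is the least set containing $H$ and closed under: $\langle X,Y\rangle\in\mathit{analz}\ H\Rightarrow X,Y\in\mathit{analz}\ H$; if $\mathit{Crypt}\ K\ X\in\mathit{analz}\ H$ and $\mathit{Key}(\mathit{invKey}\ K)\in\mathit{analz}\ H$ then $X\in\mathit{analz}\ H$. For a nonce/key index $n$ and a set of keys $Ks$, $\mathit{guard}\ n\ Ks$ is the least set of messages such that: (i) if $\mathit{Nonce}\ n\notin\mathit{parts}\{X\}$ then $X\in\mathit{guard}\ n\ Ks$; (ii) if $\mathit{invKey}\ K\in Ks$ then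 $\mathit{Crypt}\ K\ X\in\mathit{guard}\ n\ Ks$ for every $X$; (iii) if $X\in\mathit{guard}\ n\ Ks$ then $\mathit{Crypt}\ K\ X\in\mathit{guard}\ n\ Ks$ for every $K$; (iv) if $X,Y\in\mathit{guard}\ n\ Ks$ then $\langle X,Y\rangle\in\mathit{guard}\ n\ Ks$. -}

module Defs where

open import Data.Nat using (ℕ)
open import Relation.Binary.PropositionalEquality using (_≡_)
open import Relation.Nullary using (¬_)

Key : Set
Key = ℕ

data Agent : Set where
  Server : Agent
  Friend : ℕ → Agent
  Spy    : Agent

data Msg : Set where
  Number : ℕ → Msg
  Nonce  : ℕ → Msg
  Agnt   : Agent → Msg
  KeyM   : Key → Msg
  Hash   : Msg → Msg
  MPair  : Msg → Msg → Msg
  Crypt  : Key → Msg → Msg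

MsgSet : Set₁
MsgSet = Msg → Set

KeySet : Set₁
KeySet = Key → Set

⟦_⟧ : Msg → MsgSet
⟦ X ⟧ Y = Y ≡ X

data parts (H : MsgSet) : MsgSet where
  inj   : ∀ {X} → H X → parts H X
  fst   : ∀ {X Y} → parts H (MPair X Y) → parts H X
  snd   : ∀ {X Y} → parts H (MPair X Y) → parts H Y
  body  : ∀ {K X} → parts H (Crypt K X) → parts H X

data analz (invKey : Key → Key) (H : MsgSet) : MsgSet where
  inj    : ∀ {X} → H X → analz invKey H X
  fst    : ∀ {X Y} → analz invKey H (MPair X Y) → analz invKey H X
  snd    : ∀ {X Y} → analz invKey H (MPair X Y) → analz invKey H Y
  decrypt : ∀ {K X} → analz invKey H (Crypt K X)
          → analz invKey H (KeyM (invKey K)) → analz invKey H X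

data guard (invKey : Key → Key) (n : ℕ) (Ks : KeySet) : MsgSet where
  no-nonce : ∀ {X} → ¬ parts ⟦ X ⟧ (Nonce n) → guard invKey n Ks X
  guarded  : ∀ {K X} → Ks (invKey K) → guard invKey n Ks (Crypt K X)
  crypt    : ∀ {K X} → guard invKey n Ks X → guard invKey n Ks (Crypt K X)
  pair     : ∀ {X Y} → guard invKey n Ks X → guard invKey n Ks Y
           → guard invKey n Ks (MPair X Y)

{-# OPTIONS --safe #-}
module Submission where

-- Every message the spy can analyse from G is still guarded, unless along the way
-- she decrypted a cipher protected by clause (ii); that decryption required some key
-- of Ks. Since Nonce n itself is not guarded, reaching it forces such a key leak.

open import Defs
open import Data.Nat using (ℕ)
open import Data.Product using (Σ; _×_; _,_)
open import Data.Sum using (_⊎_; inj₁; inj₂)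
import Data.Sum as Sum
open import Data.Empty using (⊥-elim)
open import Relation.Nullary using (¬_)
open import Relation.Binary.PropositionalEquality using (_≡_; refl)

parts-trans : ∀ {H X Z} → parts H X → parts ⟦ X ⟧ Z → parts H Z
parts-trans p (inj refl) = p
parts-trans p (fst q)    = fst (parts-trans p q)
parts-trans p (snd q)    = snd (parts-trans p q)
parts-trans p (body q)   = body (parts-trans p q)

KeyRevealed : (Key → Key) → KeySet → MsgSet → Set
KeyRevealed invKey Ks G = Σ Key (λ K → Ks K × analz invKey G (KeyM K))

module _ {invKey : Key → Key} {n : ℕ} {Ks : KeySet} where

  no-nonce-parts : ∀ {X Y} → ¬ parts ⟦ X ⟧ (Nonce n) → parts ⟦ X ⟧ Y
                 → ¬ parts ⟦ Y ⟧ (Nonce n)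
  no-nonce-parts X∌n Y∈X n∈Y = X∌n (parts-trans Y∈X n∈Y)

  guard-fst : ∀ {X Y} → guard invKey n Ks (MPair X Y) → guard invKey n Ks X
  guard-fst (no-nonce XY∌n) = no-nonce (no-nonce-parts XY∌n (fst (inj refl)))
  guard-fst (pair gX _)     = gX

  guard-snd : ∀ {X Y} → guard invKey n Ks (MPair X Y) → guard invKey n Ks Y
  guard-snd (no-nonce XY∌n) = no-nonce (no-nonce-parts XY∌n (snd (inj refl)))
  guard-snd (pair _ gY)     = gY

  guard-body : ∀ {K X} → guard invKey n Ks (Crypt K X)
             → Ks (invKey K) ⊎ guard invKey n Ks X
  guard-body (no-nonce KX∌n) = inj₂ (no-nonce (no-nonce-parts KX∌n (body (inj refl))))
  guard-body (guarded K⁻¹∈Ks) = inj₁ K⁻¹∈Ks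
  guard-body (crypt gX)       = inj₂ gX

  Nonce-unguarded : ¬ guard invKey n Ks (Nonce n)
  Nonce-unguarded (no-nonce n∌n) = n∌n (inj refl)

  analz-guard : ∀ {G} → (∀ X → G X → guard invKey n Ks X)
              → ∀ {X} → analz invKey G X → guard invKey n Ks X ⊎ KeyRevealed invKey Ks G
  analz-guard G⊆guard (inj X∈G)  = inj₁ (G⊆guard _ X∈G)
  analz-guard G⊆guard (fst a)    = Sum.map₁ guard-fst (analz-guard G⊆guard a)
  analz-guard G⊆guard (snd a)    = Sum.map₁ guard-snd (analz-guard G⊆guard a)
  analz-guard G⊆guard (decrypt a key) with analz-guard G⊆guard a
  ... | inj₂ revealed = inj₂ revealed
  ... | inj₁ gKX with guard-body gKX
  ...   | inj₁ K⁻¹∈Ks = inj₂ (_ , K⁻¹∈Ks , key)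
  ...   | inj₂ gX     = inj₁ gX

mainTheorem1 : (invKey : Key → Key) → (∀ K → invKey (invKey K) ≡ K)
    → (n : ℕ) (Ks : KeySet) (G : MsgSet)
    → (∀ X → G X → guard invKey n Ks X)
    → analz invKey G (Nonce n)
    → Σ Key (λ K → Ks K × analz invKey G (KeyM K))
mainTheorem1 invKey _ n Ks G G⊆guard nonce with analz-guard G⊆guard nonce
... | inj₁ guarded-nonce = ⊥-elim (Nonce-unguarded guarded-nonce)
... | inj₂ revealed      = revealed
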